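{- (1) If $M:\langle\Gamma\vdash U\rangle$ is derivable then $M\in\mathcal M$, $\Gamma$ is a type environment and $U\in\mathbb U$ (the typing relation is well defined on $\mathcal M\times Env\times\mathbb U$). (2) If $M:\langle\Gamma\vdash U\rangle$ then $\Gamma$ is OK and $d(\Gamma)\succeq d(U)=d(M)$. (3) If $M:\langle\Gamma\vdash U\rangle$ and $d(U)\succeq K$ then $M^{ -K}:\langle\Gamma^{ -K}\vdash U^{ -K}\rangle$.
   Context: Indexes: finite sequences of natural numbers ($\mathcal L_{\mathbb N}$), $\oslash$ empty, $i::L$ prepending $i$, $L::K$ concatenation, $L_1\preceq L_2$ (also $L_2\succeq L_1$) iff $L_2=L_1::L_3$ for some $L_3$. Terms: over a countably infinite set $\mathcal V$, terms $\mathcal M$, free indexed variables $\mathrm{fv}$, degree $d$, joinability $\diamond$ defined simultaneously: $x^L\in\mathcal M$ ($\mathrm{fv}=\{x^L\}$, $d=L$); $MN\in\mathcal M$ when $d(M)\preceq d(N)$, $M\diamond N$ ($\mathrm{fv}$ union, $d(MN)=d(M)$); $\lambda x^L.M\in\mathcal M$ when $L\succeq d(M)$ ($\mathrm{fv}(M)\setminus\{x^L\}$, $d=d(M)$). $M\diamond N$ iff $x^L\in\mathrm{fv}(M)$, $x^K\in\mathrm{fv}(N)$ imply $L=K$. Terms modulo $\alpha$. Lifting $(x^L)^{+i}=x^{i::L}$, $(M_1M_2)^{+i}=M_1^{+i}M_2^{+i}$, $(\lambda x^L.M)^{+i}=\lambda x^{i::L}.M^{+i}$. If $d(M)=i::L$,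 $M^{ -i}$ is defined by $(x^{i::K})^{ -i}=x^K$, $(M_1M_2)^{ -i}=M_1^{ -i}M_2^{ -i}$, $(\lambda x^{i::K}.M)^{ -i}=\lambda x^K.M^{ -i}$; $M^{ -\oslash}=M$ and, if $d(M)\succeq i::L$, $M^{ -(i::L)}=(M^{ -i})^{ -L}$. Types: atomic types $\mathcal A$, expansion variables $\overline e_0,\overline e_1,\dots$; $\mathbb T\subseteq\mathbb U$ with degree: $a\in\mathbb T$ ($d=\oslash$); $U\to T\in\mathbb T$ for $U\in\mathbb U,T\in\mathbb T$ ($d=\oslash$); $\omega^L\in\mathbb U$ ($d=L$); $U_1\sqcap U_2$ if $d(U_1)=d(U_2)$ (same degree); $\overline e_iU$ ($d=i::d(U)$); modulo $\sqcap$ commutative, associative, idempotent, $\overline e_i(U_1\sqcap U_2)=\overline e_iU_1\sqcap\overline e_iU_2$, $\omega^L\sqcap U=U$ ($d(U)=L$), $\overline e_i\omega^K=\omega^{i::K}$. For $d(U)\succeq L$: $U^{ -\oslash}=U$, $(U_1\sqcap U_2)^{ -i::K}=U_1^{ -i::K}\sqcap U_2^{ -i::K}$, $(\overline e_iU)^{ -i::K}=U^{ -K}$. Environments ($Env$): finite sets $\{x_1^{L_1}:U_1,\dots,x_n^{L_n}:U_n\}$, $U_i\in\mathbb U$, giving each $x^L$ at most one type; $\Gamma,\Delta$ disjoint union; $env^\omega_M$ assigns $\omega^L$ to each $x^L\in\mathrm{fv}(M)$; $\Gamma$ is OK iff $d(U)=L$ for every $x^L:U\in\Gamma$; $\Gamma_1\sqcap\Gamma_2$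 intersects types of common variables (of equal degree), keeps others; $\overline e_j\Gamma$ replaces $x^L:U$ by $x^{j::L}:\overline e_jU$; $\Gamma_1\diamond\Gamma_2$ iff $x^L\in\mathrm{dom}\,\Gamma_1$, $x^K\in\mathrm{dom}\,\Gamma_2$ imply $L=K$; $d(\Gamma)\succeq L$ iff for all $x_i^{L_i}:U_i\in\Gamma$, $d(U_i)\succeq L$ and $L_i\succeq L$; then $L_i=L::L_i'$ and $\Gamma^{ -L}=\{x_i^{L_i'}:U_i^{ -L}\}$. Subtyping $\sqsubseteq$: least relation on types, environments and typings closed under reflexivity, transitivity, $U_1\sqcap U_2\sqsubseteq U_1$ ($d(U_1)=d(U_2)$), $U_1\sqcap U_2\sqsubseteq V_1\sqcap V_2$ if $U_i\sqsubseteq V_i$, $U_1\to T_1\sqsubseteq U_2\to T_2$ if $U_2\sqsubseteq U_1$, $T_1\sqsubseteq T_2$, $\overline e_iU_1\sqsubseteq\overline e_iU_2$ if $U_1\sqsubseteq U_2$, $\Gamma,y^L:U_1\sqsubseteq\Gamma,y^L:U_2$ if $U_1\sqsubseteq U_2$, $\langle\Gamma_1\vdash U_1\rangle\sqsubseteq\langle\Gamma_2\vdash U_2\rangle$ if $U_1\sqsubseteq U_2$, $\Gamma_2\sqsubseteq\Gamma_1$. Typing rules (with $M$ ranging over terms, $T\in\mathbb T$, $U\in\mathbb U$): (ax) $x^\oslash:\langle(x^\oslash:T)\vdash T\rangle$; ($\omega$) $M:\langle env^\omega_M\vdash\omega^{d(M)}\rangle$; ($\to_I$) $M:\langle\Gamma,(x^L:U)\vdash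 T\rangle\Rightarrow\lambda x^L.M:\langle\Gamma\vdash U\to T\rangle$; ($\to'_I$) $M:\langle\Gamma\vdash T\rangle$, $x^L\notin\mathrm{dom}\,\Gamma\Rightarrow\lambda x^L.M:\langle\Gamma\vdash\omega^L\to T\rangle$; ($\to_E$) $M_1:\langle\Gamma_1\vdash U\to T\rangle$, $M_2:\langle\Gamma_2\vdash U\rangle$, $\Gamma_1\diamond\Gamma_2\Rightarrow M_1M_2:\langle\Gamma_1\sqcap\Gamma_2\vdash T\rangle$; ($\sqcap_I$) $M:\langle\Gamma\vdash U_1\rangle$, $M:\langle\Gamma\vdash U_2\rangle\Rightarrow M:\langle\Gamma\vdash U_1\sqcap U_2\rangle$; ($e$) $M:\langle\Gamma\vdash U\rangle\Rightarrow M^{+j}:\langle\overline e_j\Gamma\vdash\overline e_jU\rangle$; ($\sqsubseteq$) $M:\langle\Gamma\vdash U\rangle$, $\langle\Gamma\vdash U\rangle\sqsubseteq\langle\Gamma'\vdash U'\rangle\Rightarrow M:\langle\Gamma'\vdash U'\rangle$. -}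

module Defs where

open import Data.Nat using (ℕ; zero; suc)
import Data.Nat as ℕ
open import Data.List using (List; []; _∷_; _++_; map; filter; deduplicate; length; drop)
import Data.List.Properties as LP
import Data.Product.Properties as PP
open import Data.List.Membership.Propositional using (_∈_; _∉_)
open import Data.List.Relation.Unary.All using (All)
open import Data.List.Relation.Unary.Unique.Propositional using (Unique)
open import Data.List.Relation.Binary.Permutation.Propositional using (_↭_)
open import Data.Product using (Σ; _×_; _,_; proj₁; proj₂)
open import Data.Maybe using (Maybe; just; nothing)
open import Relation.Binary.PropositionalEquality using (_≡_; _≢_)
open import Relation.Binary.Definitions using (DecidableEquality)
open import Relation.Nullary using (yes; no; ¬?)

Index : Set
Index = List ℕ

_≼_ : Index → Index → Set
L₁ ≼ L₂ = Σ Index (λ L₃ → L₂ ≡ L₁ ++ L₃)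

_≽_ : Index → Index → Set
L₂ ≽ L₁ = L₁ ≼ L₂

infix 4 _≼_ _≽_

_≟I_ : DecidableEquality Index
_≟I_ = LP.≡-dec ℕ._≟_

Var : Set
Var = ℕ

-- an indexed variable x^L
Key : Set
Key = Var × Index

_≟K_ : DecidableEquality Key
_≟K_ = PP.≡-dec ℕ._≟_ _≟I_

data Tm : Set where
  var : Var → Index → Tm
  app : Tm → Tm → Tm
  lam : Var → Index → Tm → Tm

fv : Tm → List Key
fv (var x L)   = (x , L) ∷ []
fv (app M N)   = fv M ++ fv N
fv (lam x L M) = filter (λ k → ¬? (k ≟K (x , L))) (fv M)

dTm : Tm → Index
dTm (var x L)   = L
dTm (app M N)   = dTm M
dTm (lam x L M) = dTm M

_◇_ : Tm → Tm → Set
M ◇ N = ∀ x L K → (x , L) ∈ fv M → (x , K) ∈ fv N → L ≡ K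

data _∈𝓜 : Tm → Set where
  var∈ : ∀ x L → var x L ∈𝓜
  app∈ : ∀ {M N} → M ∈𝓜 → N ∈𝓜 → dTm M ≼ dTm N → M ◇ N → app M N ∈𝓜
  lam∈ : ∀ {x L M} → M ∈𝓜 → L ≽ dTm M → lam x L M ∈𝓜

liftTm : ℕ → Tm → Tm
liftTm i (var x L)   = var x (i ∷ L)
liftTm i (app M N)   = app (liftTm i M) (liftTm i N)
liftTm i (lam x L M) = lam x (i ∷ L) (liftTm i M)

-- M^{-i} : removes the head i of every index (only meaningful when
-- d(M) = i :: L; the [] case is junk and never used under that hypothesis)
tailI : Index → Index
tailI []      = []
tailI (_ ∷ L) = L

lower1Tm : ℕ → Tm → Tm
lower1Tm i (var x L)   = var x (tailI L)
lower1Tm i (app M N)   = app (lower1Tm i M) (lower1Tm i N)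
lower1Tm i (lam x L M) = lam x (tailI L) (lower1Tm i M)

lowerTm : Index → Tm → Tm
lowerTm []      M = M
lowerTm (i ∷ K) M = lowerTm K (lower1Tm i M)

-- Types.  Atomic types A = ℕ.  Raw types; well-formedness below;
-- "modulo" the equations via the relation _≃_.

Atom : Set
Atom = ℕ

data Ty : Set where
  atom  : Atom → Ty
  arr   : Ty → Ty → Ty
  omega : Index → Ty
  inter : Ty → Ty → Ty
  exp   : ℕ → Ty → Ty

dTy : Ty → Index
dTy (atom a)      = []
dTy (arr U T)     = []
dTy (omega L)     = L
dTy (inter U₁ U₂) = dTy U₁
dTy (exp i U)     = i ∷ dTy U

data _∈𝕋 : Ty → Set
data _∈𝕌 : Ty → Set

data _∈𝕋 where
  atom∈ : ∀ a → atom a ∈𝕋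
  arr∈  : ∀ {U T} → U ∈𝕌 → T ∈𝕋 → arr U T ∈𝕋

data _∈𝕌 where
  𝕋⊆𝕌    : ∀ {T} → T ∈𝕋 → T ∈𝕌
  omega∈ : ∀ L → omega L ∈𝕌
  inter∈ : ∀ {U₁ U₂} → U₁ ∈𝕌 → U₂ ∈𝕌 → dTy U₁ ≡ dTy U₂ → inter U₁ U₂ ∈𝕌
  exp∈   : ∀ {i U} → U ∈𝕌 → exp i U ∈𝕌

data _⟶_ : Ty → Ty → Set where
  ⊓-comm    : ∀ U₁ U₂ → inter U₁ U₂ ⟶ inter U₂ U₁
  ⊓-assoc   : ∀ U₁ U₂ U₃ → inter (inter U₁ U₂) U₃ ⟶ inter U₁ (inter U₂ U₃)
  ⊓-idem    : ∀ U → inter U U ⟶ U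
  e-distr   : ∀ i U₁ U₂ → exp i (inter U₁ U₂) ⟶ inter (exp i U₁) (exp i U₂)
  ω-unit    : ∀ U → inter (omega (dTy U)) U ⟶ U
  e-ω       : ∀ i K → exp i (omega K) ⟶ omega (i ∷ K)
  ctx-arrˡ  : ∀ {U U' T} → U ⟶ U' → arr U T ⟶ arr U' T
  ctx-arrʳ  : ∀ {U T T'} → T ⟶ T' → arr U T ⟶ arr U T'
  ctx-⊓ˡ    : ∀ {U U' V} → U ⟶ U' → inter U V ⟶ inter U' V
  ctx-⊓ʳ    : ∀ {U V V'} → V ⟶ V' → inter U V ⟶ inter U V'
  ctx-exp   : ∀ {i U U'} → U ⟶ U' → exp i U ⟶ exp i U'

data _≃_ : Ty → Ty → Set where
  ≃-refl  : ∀ {U} → U ∈𝕌 → U ≃ U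
  ≃-step  : ∀ {U V} → U ∈𝕌 → V ∈𝕌 → U ⟶ V → U ≃ V
  ≃-sym   : ∀ {U V} → U ≃ V → V ≃ U
  ≃-trans : ∀ {U V W} → U ≃ V → V ≃ W → U ≃ W

-- type lowering U^{-K} (for d(U) ≽ K); uses ω^{i::L} = ē_i ω^L.
-- Remaining cases are junk (never reached under d(U) ≽ K).
lowerTy : Index → Ty → Ty
lowerTy []      U               = U
lowerTy (i ∷ K) (inter U₁ U₂)   = inter (lowerTy (i ∷ K) U₁) (lowerTy (i ∷ K) U₂)
lowerTy (i ∷ K) (exp j U)       = lowerTy K U
lowerTy (i ∷ K) (omega (j ∷ L)) = lowerTy K (omega L)
lowerTy (i ∷ K) U               = U

-- Environments: finite lists of declarations x^L : U
-- (read as finite sets; order is immaterial thanks to _↭_ below)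

Decl : Set
Decl = Key × Ty

Env : Set
Env = List Decl

dom : Env → List Key
dom Γ = map proj₁ Γ

IsEnv : Env → Set
IsEnv Γ = Unique (dom Γ) × All (λ d → proj₂ d ∈𝕌) Γ

envω : Tm → Env
envω M = map (λ k → (k , omega (proj₂ k))) (deduplicate _≟K_ (fv M))

OK : Env → Set
OK Γ = All (λ d → dTy (proj₂ d) ≡ proj₂ (proj₁ d)) Γ

lookupEnv : Key → Env → Maybe Ty
lookupEnv k []             = nothing
lookupEnv k ((k' , U) ∷ Γ) with k ≟K k'
... | yes _ = just U
... | no  _ = lookupEnv k Γ

open import Data.List.Membership.DecPropositional _≟K_ using () renaming (_∈?_ to _∈K?_)

_⊓ₑ_ : Env → Env → Env
Γ₁ ⊓ₑ Γ₂ = map meet Γ₁ ++ filter (λ d → ¬? (proj₁ d ∈K? dom Γ₁)) Γ₂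
  where
  meet : Decl → Decl
  meet (k , U) with lookupEnv k Γ₂
  ... | just V  = (k , inter U V)
  ... | nothing = (k , U)

expEnv : ℕ → Env → Env
expEnv j = map (λ { ((x , L) , U) → ((x , j ∷ L) , exp j U) })

_◇ₑ_ : Env → Env → Set
Γ₁ ◇ₑ Γ₂ = ∀ x L K → (x , L) ∈ dom Γ₁ → (x , K) ∈ dom Γ₂ → L ≡ K

_d≽_ : Env → Index → Set
Γ d≽ L = All (λ { ((x , Lᵢ) , U) → (dTy U ≽ L) × (Lᵢ ≽ L) }) Γ

lowerEnv : Index → Env → Env
lowerEnv L = map (λ { ((x , Lᵢ) , U) → ((x , drop (length L) Lᵢ) , lowerTy L U) })

data _⊑_ : Ty → Ty → Set where
  ⊑-refl  : ∀ {U V} → U ≃ V → U ⊑ V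
  ⊑-trans : ∀ {U V W} → U ⊑ V → V ⊑ W → U ⊑ W
  ⊑-⊓     : ∀ {U₁ U₂} → inter U₁ U₂ ∈𝕌 → inter U₁ U₂ ⊑ U₁
  ⊑-⊓⊓    : ∀ {U₁ U₂ V₁ V₂} → inter U₁ U₂ ∈𝕌 → inter V₁ V₂ ∈𝕌 →
            U₁ ⊑ V₁ → U₂ ⊑ V₂ → inter U₁ U₂ ⊑ inter V₁ V₂
  ⊑-→     : ∀ {U₁ U₂ T₁ T₂} → arr U₁ T₁ ∈𝕋 → arr U₂ T₂ ∈𝕋 →
            U₂ ⊑ U₁ → T₁ ⊑ T₂ → arr U₁ T₁ ⊑ arr U₂ T₂
  ⊑-e     : ∀ {i U₁ U₂} → U₁ ⊑ U₂ → exp i U₁ ⊑ exp i U₂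

data _⊑ₑ_ : Env → Env → Set where
  ⊑ₑ-refl  : ∀ {Γ Δ} → IsEnv Γ → Γ ↭ Δ → Γ ⊑ₑ Δ
  ⊑ₑ-trans : ∀ {Γ Δ Θ} → Γ ⊑ₑ Δ → Δ ⊑ₑ Θ → Γ ⊑ₑ Θ
  ⊑ₑ-ext   : ∀ {Γ y L U₁ U₂} →
             IsEnv (Γ ++ ((y , L) , U₁) ∷ []) → IsEnv (Γ ++ ((y , L) , U₂) ∷ []) →
             U₁ ⊑ U₂ → (Γ ++ ((y , L) , U₁) ∷ []) ⊑ₑ (Γ ++ ((y , L) , U₂) ∷ [])

record Typing : Set where
  constructor ⟨_⊢_⟩
  field
    env : Env
    ty  : Ty

_⊑ₜ_ : Typing → Typing → Set
⟨ Γ₁ ⊢ U₁ ⟩ ⊑ₜ ⟨ Γ₂ ⊢ U₂ ⟩ = (U₁ ⊑ U₂) × (Γ₂ ⊑ₑ Γ₁)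

data _∶_ : Tm → Typing → Set where
  ax   : ∀ {x T} → T ∈𝕋 → var x [] ∶ ⟨ ((x , []) , T) ∷ [] ⊢ T ⟩
  ω    : ∀ {M} → M ∈𝓜 → M ∶ ⟨ envω M ⊢ omega (dTm M) ⟩
  →I   : ∀ {M Γ x L U T} → T ∈𝕋 → (x , L) ∉ dom Γ →
         M ∶ ⟨ Γ ++ ((x , L) , U) ∷ [] ⊢ T ⟩ → lam x L M ∶ ⟨ Γ ⊢ arr U T ⟩
  →I'  : ∀ {M Γ x L T} → T ∈𝕋 → (x , L) ∉ dom Γ →
         M ∶ ⟨ Γ ⊢ T ⟩ → lam x L M ∶ ⟨ Γ ⊢ arr (omega L) T ⟩
  →E   : ∀ {M₁ M₂ Γ₁ Γ₂ U T} →
         M₁ ∶ ⟨ Γ₁ ⊢ arr U T ⟩ → M₂ ∶ ⟨ Γ₂ ⊢ U ⟩ → Γ₁ ◇ₑ Γ₂ →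
         app M₁ M₂ ∶ ⟨ Γ₁ ⊓ₑ Γ₂ ⊢ T ⟩
  ⊓I   : ∀ {M Γ U₁ U₂} → M ∶ ⟨ Γ ⊢ U₁ ⟩ → M ∶ ⟨ Γ ⊢ U₂ ⟩ → M ∶ ⟨ Γ ⊢ inter U₁ U₂ ⟩
  e    : ∀ {M Γ U} j → M ∶ ⟨ Γ ⊢ U ⟩ → liftTm j M ∶ ⟨ expEnv j Γ ⊢ exp j U ⟩
  sub  : ∀ {M Γ U Γ' U'} → M ∶ ⟨ Γ ⊢ U ⟩ → ⟨ Γ ⊢ U ⟩ ⊑ₜ ⟨ Γ' ⊢ U' ⟩ → M ∶ ⟨ Γ' ⊢ U' ⟩

infix 3 _∶_

-- Parts (1) and (2) are proved together by induction on the derivation: the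
-- record WellTyped collects the claimed facts together with one more invariant,
-- fv M ⊆ dom Γ, which is what makes the application rule produce joinable terms
-- (Γ₁ ◇ Γ₂ gives M₁ ◇ M₂).
--
-- Part (3) is reduced to lowering by a single index i, since M^{-(i::K)} =
-- (M^{-i})^{-K} and likewise for types and environments.  Single lowering is
-- again an induction on the derivation: the rules concluding with a type of
-- degree ⊘ cannot occur, the rule (e) is undone by lowering, the rule (ω) needs
-- that lowering commutes with env^ω, and subsumption needs that lowering
-- preserves ⊑ and (for environments whose indexes all start with i) ⊑ₑ.
module Submission where

open import Defs
open import Data.Product using (_×_; Σ; _,_; proj₁; proj₂)
open import Data.Sum using (_⊎_; inj₁; inj₂)
open import Data.Empty using (⊥; ⊥-elim)
open import Data.Nat using (ℕ)
open import Data.List using (List; []; _∷_; _++_; [_]; map; filter; deduplicate; drop; length)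
open import Data.List.Properties using (map-++; ++-assoc; ++-identityʳ; filter-accept; filter-reject)
open import Data.List.Relation.Unary.All using (All; []; _∷_)
import Data.List.Relation.Unary.All as All
import Data.List.Relation.Unary.All.Properties as AllP
import Data.List.Relation.Unary.AllPairs.Properties as AllPairsP
open import Data.List.Relation.Unary.Any using (here; there)
open import Data.List.Relation.Unary.AllPairs using ([]; _∷_)
open import Data.List.Relation.Unary.Unique.Propositional using (Unique)
import Data.List.Relation.Unary.Unique.Propositional.Properties as UniqueP
open import Data.List.Relation.Unary.Unique.DecPropositional.Properties _≟K_ using (deduplicate-!)
open import Data.List.Membership.Propositional using (_∈_)
open import Data.List.Membership.Propositional.Properties
  using (∈-map⁺; ∈-map⁻; ∈-++⁺ˡ; ∈-++⁺ʳ; ∈-++⁻; ∈-filter⁺; ∈-filter⁻; ∈-deduplicate⁺)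
open import Data.List.Membership.DecPropositional _≟K_ using () renaming (_∈?_ to _∈K?_)
open import Data.List.Relation.Binary.Permutation.Propositional using (_↭_; ↭-sym; ↭-trans; ↭-reflexive)
import Data.List.Relation.Binary.Permutation.Propositional.Properties as PermP
open import Data.Maybe using (just; nothing)
open import Relation.Binary.PropositionalEquality using (_≡_; refl; sym; trans; cong; cong₂; subst; subst₂; module ≡-Reasoning)
open import Relation.Nullary using (¬_; yes; no; ¬?)
import Relation.Unary as Pred

≼-refl : ∀ L → L ≼ L
≼-refl L = [] , sym (++-identityʳ L)

≼-trans : ∀ {A B C} → A ≼ B → B ≼ C → A ≼ C
≼-trans {A} (B' , refl) (C' , refl) = B' ++ C' , ++-assoc A B' C'

≡[]⇒≼ : ∀ {A} L → A ≡ [] → A ≼ L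
≡[]⇒≼ L refl = L , refl

∷-mono-≼ : ∀ j {A B} → A ≼ B → (j ∷ A) ≼ (j ∷ B)
∷-mono-≼ j (C , eq) = C , cong (j ∷_) eq

tail-mono-≼ : ∀ {A B} → A ≼ B → tailI A ≼ tailI B
tail-mono-≼ {[]}    {B} _  = tailI B , refl
tail-mono-≼ {a ∷ A} (C , refl) = C , refl

∷⋠[] : ∀ {i K A} → A ≡ [] → ¬ ((i ∷ K) ≼ A)
∷⋠[] refl (_ , ())

𝕋-degree : ∀ {T} → T ∈𝕋 → dTy T ≡ []
𝕋-degree (atom∈ a)  = refl
𝕋-degree (arr∈ _ _) = refl

inter-wfˡ : ∀ {U V} → inter U V ∈𝕌 → U ∈𝕌
inter-wfˡ (inter∈ u _ _) = u

arrow-wf : ∀ {U T} → arr U T ∈𝕌 → U ∈𝕌 × T ∈𝕋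
arrow-wf (𝕋⊆𝕌 (arr∈ u t)) = u , t

step-degree : ∀ {U V} → U ∈𝕌 → U ⟶ V → dTy U ≡ dTy V
step-degree (inter∈ _ _ eq) (⊓-comm _ _)    = eq
step-degree _               (⊓-assoc _ _ _) = refl
step-degree _               (⊓-idem _)      = refl
step-degree _               (e-distr _ _ _) = refl
step-degree _               (ω-unit _)      = refl
step-degree _               (e-ω _ _)       = refl
step-degree _               (ctx-arrˡ _)    = refl
step-degree _               (ctx-arrʳ _)    = refl
step-degree (inter∈ u _ _)  (ctx-⊓ˡ s)      = step-degree u s
step-degree _               (ctx-⊓ʳ _)      = refl
step-degree (exp∈ u)        (ctx-exp {i} s) = cong (i ∷_) (step-degree u s)

≃-wf : ∀ {U V} → U ≃ V → U ∈𝕌 × V ∈𝕌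
≃-wf (≃-refl u)     = u , u
≃-wf (≃-step u v _) = u , v
≃-wf (≃-sym p)      = proj₂ (≃-wf p) , proj₁ (≃-wf p)
≃-wf (≃-trans p q)  = proj₁ (≃-wf p) , proj₂ (≃-wf q)

≃-degree : ∀ {U V} → U ≃ V → dTy U ≡ dTy V
≃-degree (≃-refl _)     = refl
≃-degree (≃-step u _ s) = step-degree u s
≃-degree (≃-sym p)      = sym (≃-degree p)
≃-degree (≃-trans p q)  = trans (≃-degree p) (≃-degree q)

⊑-wf : ∀ {U V} → U ⊑ V → U ∈𝕌 × V ∈𝕌
⊑-wf (⊑-refl p)       = ≃-wf p
⊑-wf (⊑-trans p q)    = proj₁ (⊑-wf p) , proj₂ (⊑-wf q)
⊑-wf (⊑-⊓ u)          = u , inter-wfˡ u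
⊑-wf (⊑-⊓⊓ u v _ _)   = u , v
⊑-wf (⊑-→ t₁ t₂ _ _)  = 𝕋⊆𝕌 t₁ , 𝕋⊆𝕌 t₂
⊑-wf (⊑-e p)          = exp∈ (proj₁ (⊑-wf p)) , exp∈ (proj₂ (⊑-wf p))

⊑-degree : ∀ {U V} → U ⊑ V → dTy U ≡ dTy V
⊑-degree (⊑-refl p)         = ≃-degree p
⊑-degree (⊑-trans p q)      = trans (⊑-degree p) (⊑-degree q)
⊑-degree (⊑-⊓ _)            = refl
⊑-degree (⊑-⊓⊓ _ _ p _)     = ⊑-degree p
⊑-degree (⊑-→ _ _ _ _)      = refl
⊑-degree (⊑-e {i} p)        = cong (i ∷_) (⊑-degree p)

lowerTy₁ : ℕ → Ty → Ty
lowerTy₁ i = lowerTy [ i ]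

lowerTy₁-ω : ∀ i L → lowerTy₁ i (omega L) ≡ omega (tailI L)
lowerTy₁-ω i []      = refl
lowerTy₁-ω i (_ ∷ L) = refl

degree-lowerTy₁ : ∀ i U → dTy (lowerTy₁ i U) ≡ tailI (dTy U)
degree-lowerTy₁ i (atom _)        = refl
degree-lowerTy₁ i (arr _ _)       = refl
degree-lowerTy₁ i (omega [])      = refl
degree-lowerTy₁ i (omega (_ ∷ _)) = refl
degree-lowerTy₁ i (inter U _)     = degree-lowerTy₁ i U
degree-lowerTy₁ i (exp _ _)       = refl

lowerTy₁-wf : ∀ i {U} → U ∈𝕌 → lowerTy₁ i U ∈𝕌
lowerTy₁-wf i (𝕋⊆𝕌 (atom∈ a))   = 𝕋⊆𝕌 (atom∈ a)
lowerTy₁-wf i (𝕋⊆𝕌 (arr∈ u t))  = 𝕋⊆𝕌 (arr∈ u t)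
lowerTy₁-wf i (omega∈ [])      = omega∈ []
lowerTy₁-wf i (omega∈ (_ ∷ L)) = omega∈ L
lowerTy₁-wf i (inter∈ {U₁} {U₂} u₁ u₂ eq) =
  inter∈ (lowerTy₁-wf i u₁) (lowerTy₁-wf i u₂)
    (trans (degree-lowerTy₁ i U₁) (trans (cong tailI eq) (sym (degree-lowerTy₁ i U₂))))
lowerTy₁-wf i (exp∈ u)         = u

step-lowerTy₁ : ∀ i {U V} → U ⟶ V → (lowerTy₁ i U ⟶ lowerTy₁ i V) ⊎ (lowerTy₁ i U ≡ lowerTy₁ i V)
step-lowerTy₁ i (⊓-comm _ _)    = inj₁ (⊓-comm _ _)
step-lowerTy₁ i (⊓-assoc _ _ _) = inj₁ (⊓-assoc _ _ _)
step-lowerTy₁ i (⊓-idem _)      = inj₁ (⊓-idem _)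
step-lowerTy₁ i (e-distr _ _ _) = inj₂ refl
step-lowerTy₁ i (ω-unit U)
  rewrite lowerTy₁-ω i (dTy U) | sym (degree-lowerTy₁ i U) = inj₁ (ω-unit _)
step-lowerTy₁ i (e-ω _ _)       = inj₂ refl
step-lowerTy₁ i (ctx-arrˡ s)    = inj₁ (ctx-arrˡ s)
step-lowerTy₁ i (ctx-arrʳ s)    = inj₁ (ctx-arrʳ s)
step-lowerTy₁ i (ctx-⊓ˡ s) with step-lowerTy₁ i s
... | inj₁ s' = inj₁ (ctx-⊓ˡ s')
... | inj₂ eq = inj₂ (cong (λ W → inter W _) eq)
step-lowerTy₁ i (ctx-⊓ʳ s) with step-lowerTy₁ i s
... | inj₁ s' = inj₁ (ctx-⊓ʳ s')
... | inj₂ eq = inj₂ (cong (inter _) eq)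
step-lowerTy₁ i (ctx-exp s)     = inj₁ s

≃-lowerTy₁ : ∀ i {U V} → U ≃ V → lowerTy₁ i U ≃ lowerTy₁ i V
≃-lowerTy₁ i (≃-refl u) = ≃-refl (lowerTy₁-wf i u)
≃-lowerTy₁ i (≃-step u v s) with step-lowerTy₁ i s
... | inj₁ s' = ≃-step (lowerTy₁-wf i u) (lowerTy₁-wf i v) s'
... | inj₂ eq = subst (_ ≃_) eq (≃-refl (lowerTy₁-wf i u))
≃-lowerTy₁ i (≃-sym p)     = ≃-sym (≃-lowerTy₁ i p)
≃-lowerTy₁ i (≃-trans p q) = ≃-trans (≃-lowerTy₁ i p) (≃-lowerTy₁ i q)

⊑-lowerTy₁ : ∀ i {U V} → U ⊑ V → lowerTy₁ i U ⊑ lowerTy₁ i V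
⊑-lowerTy₁ i (⊑-refl p)       = ⊑-refl (≃-lowerTy₁ i p)
⊑-lowerTy₁ i (⊑-trans p q)    = ⊑-trans (⊑-lowerTy₁ i p) (⊑-lowerTy₁ i q)
⊑-lowerTy₁ i (⊑-⊓ u)          = ⊑-⊓ (lowerTy₁-wf i u)
⊑-lowerTy₁ i (⊑-⊓⊓ u v p q)   = ⊑-⊓⊓ (lowerTy₁-wf i u) (lowerTy₁-wf i v) (⊑-lowerTy₁ i p) (⊑-lowerTy₁ i q)
⊑-lowerTy₁ i (⊑-→ t₁ t₂ p q)  = ⊑-→ t₁ t₂ p q
⊑-lowerTy₁ i (⊑-e p)          = p

lowerTy-∷ : ∀ i K U → lowerTy (i ∷ K) U ≡ lowerTy K (lowerTy₁ i U)
lowerTy-∷ i []      U               = refl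
lowerTy-∷ i (_ ∷ K) (atom _)        = refl
lowerTy-∷ i (_ ∷ K) (arr _ _)       = refl
lowerTy-∷ i (_ ∷ K) (omega [])      = refl
lowerTy-∷ i (_ ∷ K) (omega (_ ∷ _)) = refl
lowerTy-∷ i (k ∷ K) (inter U V)     = cong₂ inter (lowerTy-∷ i (k ∷ K) U) (lowerTy-∷ i (k ∷ K) V)
lowerTy-∷ i (_ ∷ K) (exp _ _)       = refl

InjectiveOn : (Key → Set) → (Key → Key) → Set
InjectiveOn S f = ∀ {a b} → S a → S b → f a ≡ f b → a ≡ b

filter-map : ∀ {P Q : Key → Set} (P? : Pred.Decidable P) (Q? : Pred.Decidable Q) (f : Key → Key) xs →
  All (λ x → (Q x → P (f x)) × (P (f x) → Q x)) xs → filter P? (map f xs) ≡ map f (filter Q? xs)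
filter-map P? Q? f []       []              = refl
filter-map P? Q? f (x ∷ xs) ((to , from) ∷ hs) with Q? x
... | yes q = trans (filter-accept P? (to q)) (cong (f x ∷_) (filter-map P? Q? f xs hs))
... | no ¬q = trans (filter-reject P? (λ p → ¬q (from p))) (filter-map P? Q? f xs hs)

filter-≢-map : ∀ {S} (f : Key → Key) → InjectiveOn S f → ∀ {k₀} → S k₀ → ∀ xs → All S xs →
  filter (λ k → ¬? (k ≟K f k₀)) (map f xs) ≡ map f (filter (λ k → ¬? (k ≟K k₀)) xs)
filter-≢-map f inj s₀ xs ss =
  filter-map _ _ f xs (All.map (λ s → (λ ne eq → ne (inj s s₀ eq)) , (λ ne eq → ne (cong f eq))) ss)

deduplicate-map : ∀ {S} (f : Key → Key) → InjectiveOn S f → ∀ xs → All S xs →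
  deduplicate _≟K_ (map f xs) ≡ map f (deduplicate _≟K_ xs)
deduplicate-map f inj []       []       = refl
deduplicate-map f inj (x ∷ xs) (s ∷ ss) = cong (f x ∷_) (begin
  filter (λ k → ¬? (f x ≟K k)) (deduplicate _≟K_ (map f xs))
    ≡⟨ cong (filter (λ k → ¬? (f x ≟K k))) (deduplicate-map f inj xs ss) ⟩
  filter (λ k → ¬? (f x ≟K k)) (map f (deduplicate _≟K_ xs))
    ≡⟨ filter-map _ _ f _ (All.map (λ s' → (λ ne eq → ne (inj s s' eq)) , (λ ne eq → ne (cong f eq)))
                                   (AllP.deduplicate⁺ _≟K_ ss)) ⟩
  map f (filter (λ k → ¬? (x ≟K k)) (deduplicate _≟K_ xs)) ∎)
  where open ≡-Reasoning

Unique-map : ∀ {S} (f : Key → Key) → InjectiveOn S f → ∀ {xs} → All S xs → Unique xs → Unique (map f xs)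
Unique-map f inj []       []       = []
Unique-map f inj (s ∷ ss) (x∉ ∷ u) =
  AllP.map⁺ (All.zipWith (λ (ne , s') eq → ne (inj s s' eq)) (x∉ , ss)) ∷ Unique-map f inj ss u

liftKey : ℕ → Key → Key
liftKey j (x , L) = x , j ∷ L

tailKey : Key → Key
tailKey (x , L) = x , tailI L

liftKey-injective : ∀ j {a b} → liftKey j a ≡ liftKey j b → a ≡ b
liftKey-injective j eq = cong tailKey eq

HasHead : ℕ → Key → Set
HasHead i k = [ i ] ≼ proj₂ k

tailKey-injective : ∀ i → InjectiveOn (HasHead i) tailKey
tailKey-injective i {x , .(i ∷ L)} {y , .(i ∷ K)} (L , refl) (K , refl) eq = cong (liftKey i) eq

degree-liftTm : ∀ j M → dTm (liftTm j M) ≡ j ∷ dTm M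
degree-liftTm j (var _ _)   = refl
degree-liftTm j (app M _)   = degree-liftTm j M
degree-liftTm j (lam _ _ M) = degree-liftTm j M

degree-lower1Tm : ∀ i M → dTm (lower1Tm i M) ≡ tailI (dTm M)
degree-lower1Tm i (var _ _)   = refl
degree-lower1Tm i (app M _)   = degree-lower1Tm i M
degree-lower1Tm i (lam _ _ M) = degree-lower1Tm i M

lower1Tm-liftTm : ∀ j M → lower1Tm j (liftTm j M) ≡ M
lower1Tm-liftTm j (var _ _)   = refl
lower1Tm-liftTm j (app M N)   = cong₂ app (lower1Tm-liftTm j M) (lower1Tm-liftTm j N)
lower1Tm-liftTm j (lam x L M) = cong (lam x L) (lower1Tm-liftTm j M)

fv-degree : ∀ {M} → M ∈𝓜 → All (λ k → dTm M ≼ proj₂ k) (fv M)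
fv-degree (var∈ _ L)        = ≼-refl L ∷ []
fv-degree (app∈ m n dMN _)  = AllP.++⁺ (fv-degree m) (All.map (≼-trans dMN) (fv-degree n))
fv-degree (lam∈ m _)        = AllP.filter⁺ _ (fv-degree m)

fv-liftTm : ∀ j M → fv (liftTm j M) ≡ map (liftKey j) (fv M)
fv-liftTm j (var _ _)   = refl
fv-liftTm j (app M N)   =
  trans (cong₂ _++_ (fv-liftTm j M) (fv-liftTm j N)) (sym (map-++ (liftKey j) (fv M) (fv N)))
fv-liftTm j (lam x L M) =
  trans (cong (filter (λ k → ¬? (k ≟K (x , j ∷ L)))) (fv-liftTm j M))
        (filter-≢-map {S = λ _ → Key} (liftKey j) (λ _ _ → liftKey-injective j) (x , L) (fv M)
                      (All.universal (λ k → k) (fv M)))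

fv-lower1Tm : ∀ i {M} → M ∈𝓜 → [ i ] ≼ dTm M → fv (lower1Tm i M) ≡ map tailKey (fv M)
fv-lower1Tm i (var∈ _ _) p = refl
fv-lower1Tm i (app∈ {M} {N} m n dMN _) p =
  trans (cong₂ _++_ (fv-lower1Tm i m p) (fv-lower1Tm i n (≼-trans p dMN))) (sym (map-++ tailKey (fv M) (fv N)))
fv-lower1Tm i (lam∈ {x} {L} {M} m L≽M) p =
  trans (cong (filter (λ k → ¬? (k ≟K (x , tailI L)))) (fv-lower1Tm i m p))
        (filter-≢-map tailKey (tailKey-injective i) (≼-trans p L≽M) (fv M)
                      (All.map (≼-trans p) (fv-degree m)))

-- lifting, and lowering by the head of the degree, preserve well-formed terms;
-- joinability survives because free variables are mapped injectively
liftTm-wf : ∀ j {M} → M ∈𝓜 → liftTm j M ∈𝓜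
liftTm-wf j (var∈ x L) = var∈ x (j ∷ L)
liftTm-wf j (app∈ {M} {N} m n dMN M◇N) =
  app∈ (liftTm-wf j m) (liftTm-wf j n)
       (subst₂ _≼_ (sym (degree-liftTm j M)) (sym (degree-liftTm j N)) (∷-mono-≼ j dMN)) joinable
  where
  joinable : liftTm j M ◇ liftTm j N
  joinable x L K a b
    with ∈-map⁻ (liftKey j) (subst (_ ∈_) (fv-liftTm j M) a)
       | ∈-map⁻ (liftKey j) (subst (_ ∈_) (fv-liftTm j N) b)
  ... | (_ , L₀) , a₀ , refl | (_ , K₀) , b₀ , refl = cong (j ∷_) (M◇N x L₀ K₀ a₀ b₀)
liftTm-wf j (lam∈ {x} {L} {M} m L≽M) =
  lam∈ (liftTm-wf j m) (subst (_≼ (j ∷ L)) (sym (degree-liftTm j M)) (∷-mono-≼ j L≽M))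

lower1Tm-wf : ∀ i {M} → M ∈𝓜 → [ i ] ≼ dTm M → lower1Tm i M ∈𝓜
lower1Tm-wf i (var∈ x L) p = var∈ x (tailI L)
lower1Tm-wf i (app∈ {M} {N} m n dMN M◇N) p =
  app∈ (lower1Tm-wf i m p) (lower1Tm-wf i n pN)
       (subst₂ _≼_ (sym (degree-lower1Tm i M)) (sym (degree-lower1Tm i N)) (tail-mono-≼ dMN)) joinable
  where
  pN : [ i ] ≼ dTm N
  pN = ≼-trans p dMN
  joinable : lower1Tm i M ◇ lower1Tm i N
  joinable x L K a b
    with ∈-map⁻ tailKey (subst (_ ∈_) (fv-lower1Tm i m p) a)
       | ∈-map⁻ tailKey (subst (_ ∈_) (fv-lower1Tm i n pN) b)
  ... | k₁ , a₁ , e₁ | k₂ , b₂ , e₂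
    with ≼-trans p (All.lookup (fv-degree m) a₁) | ≼-trans pN (All.lookup (fv-degree n) b₂)
  joinable x L K a b | (_ , .(i ∷ L₁)) , a₁ , refl | (_ , .(i ∷ K₁)) , b₂ , refl | L₁ , refl | K₁ , refl =
    cong tailI (M◇N _ (i ∷ L₁) (i ∷ K₁) a₁ b₂)
lower1Tm-wf i (lam∈ {x} {L} {M} m L≽M) p =
  lam∈ (lower1Tm-wf i m p) (subst (_≼ tailI L) (sym (degree-lower1Tm i M)) (tail-mono-≼ L≽M))

WfDecl : Decl → Set
WfDecl d = proj₂ d ∈𝕌

OkDecl : Decl → Set
OkDecl d = dTy (proj₂ d) ≡ proj₂ (proj₁ d)

dom-++ : ∀ Γ Δ → dom (Γ ++ Δ) ≡ dom Γ ++ dom Δ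
dom-++ = map-++ proj₁

Unique-++ˡ : ∀ {xs ys : List Key} → Unique (xs ++ ys) → Unique xs
Unique-++ˡ {[]}     _       = []
Unique-++ˡ {x ∷ xs} (a ∷ u) = AllP.++⁻ˡ xs a ∷ Unique-++ˡ u

IsEnv-++ˡ : ∀ Γ {Δ} → IsEnv (Γ ++ Δ) → IsEnv Γ
IsEnv-++ˡ Γ (u , wf) = Unique-++ˡ (subst Unique (dom-++ Γ _) u) , AllP.++⁻ˡ Γ wf

d≽[] : ∀ Γ → Γ d≽ []
d≽[] = All.universal (λ d → (dTy (proj₂ d) , refl) , (proj₂ (proj₁ d) , refl))

dom-expEnv : ∀ j Γ → dom (expEnv j Γ) ≡ map (liftKey j) (dom Γ)
dom-expEnv j []      = refl
dom-expEnv j (_ ∷ Γ) = cong (_ ∷_) (dom-expEnv j Γ)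

expEnv-wf : ∀ j {Γ} → IsEnv Γ → OK Γ → IsEnv (expEnv j Γ) × OK (expEnv j Γ)
expEnv-wf j {Γ} (u , wf) ok =
  (subst Unique (sym (dom-expEnv j Γ)) (UniqueP.map⁺ (liftKey-injective j) u) , go-wf Γ wf) , go-ok Γ ok
  where
  go-wf : ∀ Γ → All WfDecl Γ → All WfDecl (expEnv j Γ)
  go-wf []      []       = []
  go-wf (_ ∷ Γ) (w ∷ ws) = exp∈ w ∷ go-wf Γ ws
  go-ok : ∀ Γ → OK Γ → OK (expEnv j Γ)
  go-ok []      []       = []
  go-ok (_ ∷ Γ) (o ∷ os) = cong (j ∷_) o ∷ go-ok Γ os

expEnv-degree : ∀ j {K} Γ → Γ d≽ K → expEnv j Γ d≽ (j ∷ K)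
expEnv-degree j []      []             = []
expEnv-degree j (_ ∷ Γ) ((p , q) ∷ ps) = (∷-mono-≼ j p , ∷-mono-≼ j q) ∷ expEnv-degree j Γ ps

lowerEnv-[] : ∀ Γ → lowerEnv [] Γ ≡ Γ
lowerEnv-[] []      = refl
lowerEnv-[] (_ ∷ Γ) = cong (_ ∷_) (lowerEnv-[] Γ)

drop-[] : ∀ (K : Index) → drop {A = ℕ} (length K) [] ≡ []
drop-[] []      = refl
drop-[] (_ ∷ _) = refl

lowerEnv-∷ : ∀ i K Γ → lowerEnv (i ∷ K) Γ ≡ lowerEnv K (lowerEnv [ i ] Γ)
lowerEnv-∷ i K [] = refl
lowerEnv-∷ i K (((x , []) , U) ∷ Γ) =
  cong₂ _∷_ (cong₂ _,_ (cong (x ,_) (sym (drop-[] K))) (lowerTy-∷ i K U)) (lowerEnv-∷ i K Γ)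
lowerEnv-∷ i K (((x , _ ∷ L) , U) ∷ Γ) = cong₂ _∷_ (cong (_ ,_) (lowerTy-∷ i K U)) (lowerEnv-∷ i K Γ)

lowerEnv-expEnv : ∀ j Γ → lowerEnv [ j ] (expEnv j Γ) ≡ Γ
lowerEnv-expEnv j []      = refl
lowerEnv-expEnv j (_ ∷ Γ) = cong (_ ∷_) (lowerEnv-expEnv j Γ)

lowerEnv-++ : ∀ K Γ Δ → lowerEnv K (Γ ++ Δ) ≡ lowerEnv K Γ ++ lowerEnv K Δ
lowerEnv-++ K = map-++ _

dom-lowerEnv : ∀ i Γ → dom (lowerEnv [ i ] Γ) ≡ map tailKey (dom Γ)
dom-lowerEnv i []                   = refl
dom-lowerEnv i (((_ , []) , _) ∷ Γ)    = cong (_ ∷_) (dom-lowerEnv i Γ)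
dom-lowerEnv i (((_ , _ ∷ _) , _) ∷ Γ) = cong (_ ∷_) (dom-lowerEnv i Γ)

HeadedBy : ℕ → Env → Set
HeadedBy i = All (λ d → HasHead i (proj₁ d))

lowerEnv-IsEnv : ∀ i Γ → HeadedBy i Γ → IsEnv Γ → IsEnv (lowerEnv [ i ] Γ)
lowerEnv-IsEnv i Γ hd (u , wf) =
  subst Unique (sym (dom-lowerEnv i Γ)) (Unique-map tailKey (tailKey-injective i) (AllP.map⁺ hd) u) ,
  AllP.map⁺ (All.map (lowerTy₁-wf i) wf)

DeclProp : (Key → Index → Set) → Env → Set
DeclProp P = All (λ d → P (proj₁ d) (dTy (proj₂ d)))

-- such properties are invariant under ⊑ₑ, since ⊑ preserves degrees
⊑ₑ-DeclProp : ∀ P {Γ Δ} → Γ ⊑ₑ Δ → (DeclProp P Γ → DeclProp P Δ) × (DeclProp P Δ → DeclProp P Γ)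
⊑ₑ-DeclProp P (⊑ₑ-refl _ p)      = PermP.All-resp-↭ p , PermP.All-resp-↭ (↭-sym p)
⊑ₑ-DeclProp P (⊑ₑ-trans p q)     =
  (λ h → proj₁ (⊑ₑ-DeclProp P q) (proj₁ (⊑ₑ-DeclProp P p) h)) ,
  (λ h → proj₂ (⊑ₑ-DeclProp P p) (proj₂ (⊑ₑ-DeclProp P q) h))
⊑ₑ-DeclProp P (⊑ₑ-ext {Γ} _ _ p) = replaceLast Γ (⊑-degree p) , replaceLast Γ (sym (⊑-degree p))
  where
  replaceLast : ∀ Γ {k U₁ U₂} → dTy U₁ ≡ dTy U₂ →
    DeclProp P (Γ ++ [ (k , U₁) ]) → DeclProp P (Γ ++ [ (k , U₂) ])
  replaceLast []      {k} eq (h ∷ []) = subst (P k) eq h ∷ []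
  replaceLast (_ ∷ Γ) eq     (h ∷ hs) = h ∷ replaceLast Γ eq hs

⊑ₑ-IsEnv : ∀ {Γ Δ} → Γ ⊑ₑ Δ → IsEnv Γ
⊑ₑ-IsEnv (⊑ₑ-refl ie _)   = ie
⊑ₑ-IsEnv (⊑ₑ-trans p _)   = ⊑ₑ-IsEnv p
⊑ₑ-IsEnv (⊑ₑ-ext ie _ _)  = ie

⊑ₑ-dom : ∀ {Γ Δ} → Γ ⊑ₑ Δ → dom Γ ↭ dom Δ
⊑ₑ-dom (⊑ₑ-refl _ p)       = PermP.map⁺ proj₁ p
⊑ₑ-dom (⊑ₑ-trans p q)      = ↭-trans (⊑ₑ-dom p) (⊑ₑ-dom q)
⊑ₑ-dom (⊑ₑ-ext {Γ} _ _ _)  = ↭-reflexive (trans (dom-++ Γ _) (sym (dom-++ Γ _)))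

⊑ₑ-HeadedBy : ∀ i {Γ Δ} → Γ ⊑ₑ Δ → HeadedBy i Γ → HeadedBy i Δ
⊑ₑ-HeadedBy i p = proj₁ (⊑ₑ-DeclProp (λ k _ → HasHead i k) p)

⊑ₑ-lowerEnv : ∀ i {Γ Δ} → Γ ⊑ₑ Δ → HeadedBy i Γ → lowerEnv [ i ] Γ ⊑ₑ lowerEnv [ i ] Δ
⊑ₑ-lowerEnv i {Γ} (⊑ₑ-refl ie p) hd = ⊑ₑ-refl (lowerEnv-IsEnv i Γ hd ie) (PermP.map⁺ _ p)
⊑ₑ-lowerEnv i (⊑ₑ-trans p q) hd =
  ⊑ₑ-trans (⊑ₑ-lowerEnv i p hd) (⊑ₑ-lowerEnv i q (⊑ₑ-HeadedBy i p hd))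
⊑ₑ-lowerEnv i (⊑ₑ-ext {Γ} ie₁ ie₂ p) hd =
  subst₂ _⊑ₑ_ (sym (lowerEnv-++ [ i ] Γ _)) (sym (lowerEnv-++ [ i ] Γ _))
    (⊑ₑ-ext (subst IsEnv (lowerEnv-++ [ i ] Γ _) (lowerEnv-IsEnv i _ hd ie₁))
            (subst IsEnv (lowerEnv-++ [ i ] Γ _) (lowerEnv-IsEnv i _ hd₂ ie₂))
            (⊑-lowerTy₁ i p))
  where
  hd₂ : HeadedBy i (Γ ++ [ ((_ , _) , _) ])
  hd₂ = ⊑ₑ-HeadedBy i (⊑ₑ-ext ie₁ ie₂ p) hd

rest : Env → Env → Env
rest Γ₁ Γ₂ = filter (λ d → ¬? (proj₁ d ∈K? dom Γ₁)) Γ₂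

-- Γ₁ ⊓ₑ Γ₂ maps each declaration of Γ₁ through a local function; naming that
-- function (through unification) lets us reason about it.
⊓ₑ-shape : ∀ Γ₁ Γ₂ → Σ (Decl → Decl) λ meet → Γ₁ ⊓ₑ Γ₂ ≡ map meet Γ₁ ++ rest Γ₁ Γ₂
⊓ₑ-shape Γ₁ Γ₂ = _ , refl

meetDecl : Env → Env → Decl → Decl
meetDecl Γ₁ Γ₂ = proj₁ (⊓ₑ-shape Γ₁ Γ₂)

meetDecl-key : ∀ Γ₁ Γ₂ d → proj₁ (meetDecl Γ₁ Γ₂ d) ≡ proj₁ d
meetDecl-key Γ₁ Γ₂ (k , _) with lookupEnv k Γ₂
... | just _  = refl
... | nothing = refl

lookupEnv-∈ : ∀ k Γ {V} → lookupEnv k Γ ≡ just V → (k , V) ∈ Γ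
lookupEnv-∈ k ((k' , U) ∷ Γ) eq with k ≟K k'
lookupEnv-∈ k ((.k , U) ∷ Γ) refl | yes refl = here refl
... | no _ = there (lookupEnv-∈ k Γ eq)

meetDecl-wf : ∀ Γ₁ Γ₂ → All WfDecl Γ₂ → OK Γ₂ → ∀ d → WfDecl d → OkDecl d →
  WfDecl (meetDecl Γ₁ Γ₂ d) × OkDecl (meetDecl Γ₁ Γ₂ d)
meetDecl-wf Γ₁ Γ₂ wf₂ ok₂ (k , U) u o with lookupEnv k Γ₂ in eq
... | just V  = inter∈ u (All.lookup wf₂ V∈) (trans o (sym (All.lookup ok₂ V∈))) , o
  where V∈ = lookupEnv-∈ k Γ₂ eq
... | nothing = u , o

dom-⊓ₑ : ∀ Γ₁ Γ₂ → dom (Γ₁ ⊓ₑ Γ₂) ≡ dom Γ₁ ++ dom (rest Γ₁ Γ₂)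
dom-⊓ₑ Γ₁ Γ₂ = begin
  dom (map (meetDecl Γ₁ Γ₂) Γ₁ ++ rest Γ₁ Γ₂)        ≡⟨ dom-++ (map (meetDecl Γ₁ Γ₂) Γ₁) _ ⟩
  dom (map (meetDecl Γ₁ Γ₂) Γ₁) ++ dom (rest Γ₁ Γ₂)  ≡⟨ cong (_++ dom (rest Γ₁ Γ₂)) (keys Γ₁) ⟩
  dom Γ₁ ++ dom (rest Γ₁ Γ₂)                         ∎
  where
  open ≡-Reasoning
  keys : ∀ xs → dom (map (meetDecl Γ₁ Γ₂) xs) ≡ dom xs
  keys []       = refl
  keys (d ∷ xs) = cong₂ _∷_ (meetDecl-key Γ₁ Γ₂ d) (keys xs)

dom-rest : ∀ Γ₁ Γ₂ → Unique (dom Γ₂) → Unique (dom (rest Γ₁ Γ₂))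
dom-rest Γ₁ Γ₂ u = AllPairsP.map⁺ (AllPairsP.filter⁺ _ (AllPairsP.map⁻ u))

rest-disjoint : ∀ Γ₁ Γ₂ {k} → k ∈ dom Γ₁ → k ∈ dom (rest Γ₁ Γ₂) → ⊥
rest-disjoint Γ₁ Γ₂ k∈Γ₁ k∈rest with ∈-map⁻ proj₁ k∈rest
... | d , d∈ , refl = proj₂ (∈-filter⁻ (λ d → ¬? (proj₁ d ∈K? dom Γ₁)) {d} {Γ₂} d∈) k∈Γ₁

⊓ₑ-wf : ∀ Γ₁ Γ₂ → IsEnv Γ₁ → IsEnv Γ₂ → OK Γ₁ → OK Γ₂ → IsEnv (Γ₁ ⊓ₑ Γ₂) × OK (Γ₁ ⊓ₑ Γ₂)
⊓ₑ-wf Γ₁ Γ₂ (u₁ , wf₁) (u₂ , wf₂) ok₁ ok₂ =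
  ( subst Unique (sym (dom-⊓ₑ Γ₁ Γ₂))
      (UniqueP.++⁺ u₁ (dom-rest Γ₁ Γ₂ u₂) (λ (a , b) → rest-disjoint Γ₁ Γ₂ a b))
  , AllP.++⁺ (AllP.map⁺ (All.map proj₁ meets)) (AllP.filter⁺ _ wf₂) )
  , AllP.++⁺ (AllP.map⁺ (All.map proj₂ meets)) (AllP.filter⁺ _ ok₂)
  where
  meets : All (λ d → WfDecl (meetDecl Γ₁ Γ₂ d) × OkDecl (meetDecl Γ₁ Γ₂ d)) Γ₁
  meets = All.zipWith (λ (w , o) → meetDecl-wf Γ₁ Γ₂ wf₂ ok₂ _ w o) (wf₁ , ok₁)

dom-⊓ₑ⁺ : ∀ Γ₁ Γ₂ {k} → k ∈ dom Γ₁ ⊎ k ∈ dom Γ₂ → k ∈ dom (Γ₁ ⊓ₑ Γ₂)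
dom-⊓ₑ⁺ Γ₁ Γ₂ (inj₁ k∈Γ₁) = subst (_ ∈_) (sym (dom-⊓ₑ Γ₁ Γ₂)) (∈-++⁺ˡ k∈Γ₁)
dom-⊓ₑ⁺ Γ₁ Γ₂ {k} (inj₂ k∈Γ₂) with k ∈K? dom Γ₁
... | yes k∈Γ₁ = dom-⊓ₑ⁺ Γ₁ Γ₂ (inj₁ k∈Γ₁)
... | no  k∉Γ₁ with ∈-map⁻ proj₁ k∈Γ₂
... | d , d∈ , refl = subst (_ ∈_) (sym (dom-⊓ₑ Γ₁ Γ₂))
        (∈-++⁺ʳ (dom Γ₁) (∈-map⁺ proj₁ (∈-filter⁺ (λ d → ¬? (proj₁ d ∈K? dom Γ₁)) d∈ k∉Γ₁)))

omegaDecl : Key → Decl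
omegaDecl k = k , omega (proj₂ k)

dom-omegaDecls : ∀ ks → dom (map omegaDecl ks) ≡ ks
dom-omegaDecls []       = refl
dom-omegaDecls (k ∷ ks) = cong (k ∷_) (dom-omegaDecls ks)

lowerEnv-omegaDecls : ∀ i ks → lowerEnv [ i ] (map omegaDecl ks) ≡ map omegaDecl (map tailKey ks)
lowerEnv-omegaDecls i []                  = refl
lowerEnv-omegaDecls i ((_ , []) ∷ ks)     = cong (_ ∷_) (lowerEnv-omegaDecls i ks)
lowerEnv-omegaDecls i ((_ , _ ∷ _) ∷ ks)  = cong (_ ∷_) (lowerEnv-omegaDecls i ks)

lowerEnv-envω : ∀ i {M} → M ∈𝓜 → [ i ] ≼ dTm M → lowerEnv [ i ] (envω M) ≡ envω (lower1Tm i M)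
lowerEnv-envω i {M} m p = begin
  lowerEnv [ i ] (map omegaDecl (deduplicate _≟K_ (fv M)))
    ≡⟨ lowerEnv-omegaDecls i _ ⟩
  map omegaDecl (map tailKey (deduplicate _≟K_ (fv M)))
    ≡⟨ cong (map omegaDecl) (sym (deduplicate-map tailKey (tailKey-injective i) (fv M) heads)) ⟩
  map omegaDecl (deduplicate _≟K_ (map tailKey (fv M)))
    ≡⟨ cong (λ ks → map omegaDecl (deduplicate _≟K_ ks)) (sym (fv-lower1Tm i m p)) ⟩
  envω (lower1Tm i M) ∎
  where
  open ≡-Reasoning
  heads : All (HasHead i) (fv M)
  heads = All.map (≼-trans p) (fv-degree m)

-- Parts (1) and (2): the invariant of derivable typings

record WellTyped (M : Tm) (Γ : Env) (U : Ty) : Set where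
  field
    term-wf    : M ∈𝓜
    env-wf     : IsEnv Γ
    type-wf    : U ∈𝕌
    env-ok     : OK Γ
    env-degree : Γ d≽ dTy U
    degree     : dTy U ≡ dTm M
    fv⊆dom     : ∀ {k} → k ∈ fv M → k ∈ dom Γ

open WellTyped

wt-ax : ∀ {x T} → T ∈𝕋 → WellTyped (var x []) [ ((x , []) , T) ] T
wt-ax t = record
  { term-wf    = var∈ _ []
  ; env-wf     = ([] ∷ []) , (𝕋⊆𝕌 t ∷ [])
  ; type-wf    = 𝕋⊆𝕌 t
  ; env-ok     = 𝕋-degree t ∷ []
  ; env-degree = (≼-refl _ , ≡[]⇒≼ [] (𝕋-degree t)) ∷ []
  ; degree     = 𝕋-degree t
  ; fv⊆dom     = λ k∈ → k∈
  }

wt-ω : ∀ {M} → M ∈𝓜 → WellTyped M (envω M) (omega (dTm M))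
wt-ω {M} m = record
  { term-wf    = m
  ; env-wf     = subst Unique (sym (dom-omegaDecls ks)) (deduplicate-! (fv M))
               , AllP.map⁺ (All.universal (λ k → omega∈ (proj₂ k)) ks)
  ; type-wf    = omega∈ (dTm M)
  ; env-ok     = AllP.map⁺ (All.universal (λ _ → refl) ks)
  ; env-degree = AllP.map⁺ (All.map (λ q → q , q) (AllP.deduplicate⁺ _≟K_ (fv-degree m)))
  ; degree     = refl
  ; fv⊆dom     = λ k∈ → subst (_ ∈_) (sym (dom-omegaDecls ks)) (∈-deduplicate⁺ _≟K_ k∈)
  }
  where
  ks : List Key
  ks = deduplicate _≟K_ (fv M)

fv-lam⁻ : ∀ {x L M k} → k ∈ fv (lam x L M) → k ∈ fv M × ¬ (k ≡ (x , L))
fv-lam⁻ {x} {L} {M} {k} = ∈-filter⁻ (λ k → ¬? (k ≟K (x , L))) {k} {fv M}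

wt-→I : ∀ {M Γ x L U T} → T ∈𝕋 → WellTyped M (Γ ++ [ ((x , L) , U) ]) T → WellTyped (lam x L M) Γ (arr U T)
wt-→I {M} {Γ} {x} {L} {U} {T} t wt = record
  { term-wf    = lam∈ (term-wf wt) (subst (_≼ L) (degree wt) (proj₂ x-degree))
  ; env-wf     = IsEnv-++ˡ Γ (env-wf wt)
  ; type-wf    = 𝕋⊆𝕌 (arr∈ (All.head (AllP.++⁻ʳ Γ (proj₂ (env-wf wt)))) t)
  ; env-ok     = AllP.++⁻ˡ Γ (env-ok wt)
  ; env-degree = d≽[] Γ
  ; degree     = trans (sym (𝕋-degree t)) (degree wt)
  ; fv⊆dom     = fv⊆Γ
  }
  where
  x-degree : (dTy U ≽ dTy T) × (L ≽ dTy T)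
  x-degree = All.head (AllP.++⁻ʳ Γ (env-degree wt))
  fv⊆Γ : ∀ {k} → k ∈ fv (lam x L M) → k ∈ dom Γ
  fv⊆Γ k∈ with fv-lam⁻ {M = M} k∈
  ... | k∈M , k≢x with ∈-++⁻ (dom Γ) (subst (_ ∈_) (dom-++ Γ _) (fv⊆dom wt k∈M))
  ... | inj₁ k∈Γ        = k∈Γ
  ... | inj₂ (here k≡x) = ⊥-elim (k≢x k≡x)

wt-→I' : ∀ {M Γ x L T} → T ∈𝕋 → WellTyped M Γ T → WellTyped (lam x L M) Γ (arr (omega L) T)
wt-→I' {M} {L = L} t wt = record
  { term-wf    = lam∈ (term-wf wt) (≡[]⇒≼ L (trans (sym (degree wt)) (𝕋-degree t)))
  ; env-wf     = env-wf wt
  ; type-wf    = 𝕋⊆𝕌 (arr∈ (omega∈ L) t)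
  ; env-ok     = env-ok wt
  ; env-degree = d≽[] _
  ; degree     = trans (sym (𝕋-degree t)) (degree wt)
  ; fv⊆dom     = λ k∈ → fv⊆dom wt (proj₁ (fv-lam⁻ {M = M} k∈))
  }

wt-→E : ∀ {M₁ M₂ Γ₁ Γ₂ U T} → WellTyped M₁ Γ₁ (arr U T) → WellTyped M₂ Γ₂ U → Γ₁ ◇ₑ Γ₂ →
  WellTyped (app M₁ M₂) (Γ₁ ⊓ₑ Γ₂) T
wt-→E {M₁} {M₂} {Γ₁} {Γ₂} {T = T} wt₁ wt₂ Γ₁◇Γ₂ = record
  { term-wf    = app∈ (term-wf wt₁) (term-wf wt₂) (≡[]⇒≼ _ (sym (degree wt₁)))
                      (λ x L K a b → Γ₁◇Γ₂ x L K (fv⊆dom wt₁ a) (fv⊆dom wt₂ b))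
  ; env-wf     = proj₁ meet-wf
  ; type-wf    = 𝕋⊆𝕌 t
  ; env-ok     = proj₂ meet-wf
  ; env-degree = subst (_ d≽_) (sym (𝕋-degree t)) (d≽[] _)
  ; degree     = trans (𝕋-degree t) (degree wt₁)
  ; fv⊆dom     = λ k∈ → dom-⊓ₑ⁺ Γ₁ Γ₂ (fv⊆dom₁₂ k∈)
  }
  where
  t : T ∈𝕋
  t = proj₂ (arrow-wf (type-wf wt₁))
  meet-wf : IsEnv (Γ₁ ⊓ₑ Γ₂) × OK (Γ₁ ⊓ₑ Γ₂)
  meet-wf = ⊓ₑ-wf Γ₁ Γ₂ (env-wf wt₁) (env-wf wt₂) (env-ok wt₁) (env-ok wt₂)
  fv⊆dom₁₂ : ∀ {k} → k ∈ fv (app M₁ M₂) → k ∈ dom Γ₁ ⊎ k ∈ dom Γ₂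
  fv⊆dom₁₂ k∈ with ∈-++⁻ (fv M₁) k∈
  ... | inj₁ k∈M₁ = inj₁ (fv⊆dom wt₁ k∈M₁)
  ... | inj₂ k∈M₂ = inj₂ (fv⊆dom wt₂ k∈M₂)

wt-⊓I : ∀ {M Γ U₁ U₂} → WellTyped M Γ U₁ → WellTyped M Γ U₂ → WellTyped M Γ (inter U₁ U₂)
wt-⊓I wt₁ wt₂ = record
  { term-wf    = term-wf wt₁
  ; env-wf     = env-wf wt₁
  ; type-wf    = inter∈ (type-wf wt₁) (type-wf wt₂) (trans (degree wt₁) (sym (degree wt₂)))
  ; env-ok     = env-ok wt₁
  ; env-degree = env-degree wt₁
  ; degree     = degree wt₁
  ; fv⊆dom     = fv⊆dom wt₁
  }

wt-e : ∀ {M Γ U} j → WellTyped M Γ U → WellTyped (liftTm j M) (expEnv j Γ) (exp j U)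
wt-e {M} {Γ} j wt = record
  { term-wf    = liftTm-wf j (term-wf wt)
  ; env-wf     = proj₁ lifted
  ; type-wf    = exp∈ (type-wf wt)
  ; env-ok     = proj₂ lifted
  ; env-degree = expEnv-degree j Γ (env-degree wt)
  ; degree     = trans (cong (j ∷_) (degree wt)) (sym (degree-liftTm j M))
  ; fv⊆dom     = fv⊆dom'
  }
  where
  lifted : IsEnv (expEnv j Γ) × OK (expEnv j Γ)
  lifted = expEnv-wf j (env-wf wt) (env-ok wt)
  fv⊆dom' : ∀ {k} → k ∈ fv (liftTm j M) → k ∈ dom (expEnv j Γ)
  fv⊆dom' k∈ with ∈-map⁻ (liftKey j) (subst (_ ∈_) (fv-liftTm j M) k∈)
  ... | _ , k∈M , refl = subst (_ ∈_) (sym (dom-expEnv j Γ)) (∈-map⁺ (liftKey j) (fv⊆dom wt k∈M))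

wt-sub : ∀ {M Γ U Γ' U'} → WellTyped M Γ U → ⟨ Γ ⊢ U ⟩ ⊑ₜ ⟨ Γ' ⊢ U' ⟩ → WellTyped M Γ' U'
wt-sub {Γ = Γ} {U' = U'} wt (U⊑U' , Γ'⊑Γ) = record
  { term-wf    = term-wf wt
  ; env-wf     = ⊑ₑ-IsEnv Γ'⊑Γ
  ; type-wf    = proj₂ (⊑-wf U⊑U')
  ; env-ok     = proj₂ (⊑ₑ-DeclProp (λ k D → D ≡ proj₂ k) Γ'⊑Γ) (env-ok wt)
  ; env-degree = proj₂ (⊑ₑ-DeclProp (λ k D → (D ≽ dTy U') × (proj₂ k ≽ dTy U')) Γ'⊑Γ)
                       (subst (Γ d≽_) (⊑-degree U⊑U') (env-degree wt))
  ; degree     = trans (sym (⊑-degree U⊑U')) (degree wt)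
  ; fv⊆dom     = λ k∈ → PermP.Any-resp-↭ (↭-sym (⊑ₑ-dom Γ'⊑Γ)) (fv⊆dom wt k∈)
  }

well-typed : ∀ {M Γ U} → M ∶ ⟨ Γ ⊢ U ⟩ → WellTyped M Γ U
well-typed (ax t)        = wt-ax t
well-typed (ω m)         = wt-ω m
well-typed (→I t _ D)    = wt-→I t (well-typed D)
well-typed (→I' t _ D)   = wt-→I' t (well-typed D)
well-typed (→E D₁ D₂ j)  = wt-→E (well-typed D₁) (well-typed D₂) j
well-typed (⊓I D₁ D₂)    = wt-⊓I (well-typed D₁) (well-typed D₂)
well-typed (e j D)       = wt-e j (well-typed D)
well-typed (sub D p)     = wt-sub (well-typed D) p

-- Part (3): lowering a typing

lower₁-typing : ∀ {M Γ U} i → M ∶ ⟨ Γ ⊢ U ⟩ → [ i ] ≼ dTy U →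
  lower1Tm i M ∶ ⟨ lowerEnv [ i ] Γ ⊢ lowerTy₁ i U ⟩
lower₁-typing i (ax t)      p = ⊥-elim (∷⋠[] (𝕋-degree t) p)
lower₁-typing i (→I _ _ _)  (_ , ())
lower₁-typing i (→I' _ _ _) (_ , ())
lower₁-typing i (→E D₁ _ _) p = ⊥-elim (∷⋠[] (𝕋-degree (proj₂ (arrow-wf (type-wf (well-typed D₁))))) p)
lower₁-typing i (ω {M} m)   p =
  subst₂ (λ Γ U → lower1Tm i M ∶ ⟨ Γ ⊢ U ⟩) (sym (lowerEnv-envω i m p)) ω-type (ω (lower1Tm-wf i m p))
  where
  ω-type : omega (dTm (lower1Tm i M)) ≡ lowerTy₁ i (omega (dTm M))
  ω-type = trans (cong omega (degree-lower1Tm i M)) (sym (lowerTy₁-ω i (dTm M)))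
lower₁-typing i (⊓I D₁ D₂)  p =
  ⊓I (lower₁-typing i D₁ p)
     (lower₁-typing i D₂ (subst ([ i ] ≼_) (trans (degree (well-typed D₁)) (sym (degree (well-typed D₂)))) p))
lower₁-typing .j (e {M} {Γ} {U} j D) (_ , refl) =
  subst₂ (λ N Δ → N ∶ ⟨ Δ ⊢ U ⟩) (sym (lower1Tm-liftTm j M)) (sym (lowerEnv-expEnv j Γ)) D
lower₁-typing {Γ = Γ'} i (sub {U = U} D (U⊑U' , Γ'⊑Γ)) p =
  sub (lower₁-typing i D pU) (⊑-lowerTy₁ i U⊑U' , ⊑ₑ-lowerEnv i Γ'⊑Γ headed')
  where
  pU : [ i ] ≼ dTy U
  pU = subst ([ i ] ≼_) (sym (⊑-degree U⊑U')) p
  headed' : HeadedBy i Γ'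
  headed' = proj₂ (⊑ₑ-DeclProp (λ k _ → HasHead i k) Γ'⊑Γ)
                  (All.map (λ q → ≼-trans pU (proj₂ q)) (env-degree (well-typed D)))

lower-typing : ∀ {M Γ U} → M ∶ ⟨ Γ ⊢ U ⟩ → ∀ K → dTy U ≽ K → lowerTm K M ∶ ⟨ lowerEnv K Γ ⊢ lowerTy K U ⟩
lower-typing {M} {Γ} {U} D [] _ = subst (λ Δ → M ∶ ⟨ Δ ⊢ U ⟩) (sym (lowerEnv-[] Γ)) D
lower-typing {M} {Γ} {U} D (i ∷ K) (L , eq) rewrite lowerEnv-∷ i K Γ | lowerTy-∷ i K U =
  lower-typing (lower₁-typing i D (K ++ L , eq)) K (L , trans (degree-lowerTy₁ i U) (cong tailI eq))

theorem3 : ∀ {M Γ U} → M ∶ ⟨ Γ ⊢ U ⟩ →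
    ((M ∈𝓜) × IsEnv Γ × (U ∈𝕌))
    × (OK Γ × (Γ d≽ dTy U) × (dTy U ≡ dTm M))
    × (∀ K → dTy U ≽ K → lowerTm K M ∶ ⟨ lowerEnv K Γ ⊢ lowerTy K U ⟩)
theorem3 D =
  (term-wf wt , env-wf wt , type-wf wt) , (env-ok wt , env-degree wt , degree wt) , lower-typing D
  where
  wt = well-typed D
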